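{- Let $f(n)=an^{2}+bn+c$ with $a,b,c\in\mathbb{Z}$, $a$ odd and $b$ even, and suppose $b^{2}-4ac=4^{\ell}\Delta$ where $\ell$ is the largest positive integer with $4^{\ell}\mid b^2-4ac$, $\ell\geq 2$, and $\Delta\equiv m\pmod 8$ with $m\in\{2,3,5,6,7\}$. Let $0<i<\ell$. Then at level $i$ of the 2-adic valuation tree of $f$ there is exactly one terminating node and one non-terminating node; the terminating node has valuation $2(i-1)$, and $\nu_2(f(n))\geq 2i$ for every $n$ in the non-terminating node.
   Context: $\nu_2(x)$ denotes the 2-adic valuation of an integer $x$ (with $\nu_2(0)=+\infty$), $\mathbb{N}=\{0,1,2,\ldots\}$. The 2-adic valuation tree of $f$: a node at level $i\geq 0$ is a residue class $\{2^{i}q+r: q\in\mathbb{N}\}$ with $0\le r<2^i$; the root (level 0) is all of $\mathbb{N}$. A node is terminating if $\nu_2(f(n))$ is constant on its class (this constant is the valuation of the node), and non-terminating otherwise. Each non-terminating node $\{2^iq+r\}$ has two children at level $i+1$, namely $\{2^{i+1}q+r\}$ and $\{2^{i+1}q+2^i+r\}$; terminating nodes have no children, so the nodes at level $i$ are the children of the non-terminating nodes at level $i-1$. -}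

module Defs where

open import Data.Nat as ℕ using (ℕ; zero; suc)
open import Data.Integer as ℤ using (ℤ; +_)
open import Data.Integer.Divisibility using (_∣_)
open import Data.Product using (∃)
open import Data.Sum using (_⊎_)
open import Relation.Nullary using (¬_)
open import Relation.Binary.PropositionalEquality using (_≡_)

quad : ℤ → ℤ → ℤ → ℕ → ℤ
quad a b c n = a ℤ.* (+ n) ℤ.* (+ n) ℤ.+ b ℤ.* (+ n) ℤ.+ c

-- ν₂(x) = k  (exact 2-adic valuation k; never holds for x = 0, whose valuation is +∞)
ExactVal : ℤ → ℕ → Set
ExactVal x k = ((+ (2 ℕ.^ k)) ∣ x) × ¬ ((+ (2 ℕ.^ suc k)) ∣ x)
  where open import Data.Product using (_×_)

elt : ℕ → ℕ → ℕ → ℕ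
elt i r q = 2 ℕ.^ i ℕ.* q ℕ.+ r

-- ν₂(f(n)) constant on the class {2^i q + r}: either a finite constant k,
-- or constantly +∞ (f vanishes on the whole class)
Terminating : (ℕ → ℤ) → ℕ → ℕ → Set
Terminating f i r =
  (∃ λ k → ∀ q → ExactVal (f (elt i r q)) k) ⊎ (∀ q → f (elt i r q) ≡ + 0)

-- the nodes of the 2-adic valuation tree of f: IsNode f i r means the class
-- {2^i q + r} is a node at level i
data IsNode (f : ℕ → ℤ) : ℕ → ℕ → Set where
  root   : IsNode f 0 0
  child₀ : ∀ {i r} → IsNode f i r → ¬ Terminating f i r → IsNode f (suc i) r
  child₁ : ∀ {i r} → IsNode f i r → ¬ Terminating f i r → IsNode f (suc i) (2 ℕ.^ i ℕ.+ r)

-- Write b = 2b₀ and X(n) = an + b₀, so that completing the square gives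
-- a·f(n) = X(n)² − 4^L·Δ with L = ℓ − 1; as a is odd, ν₂(f(n)) is governed by X(n).
-- On a class {2^i q + r} we have X(n) = X(r) + a·2^i·q.  If 2^j exactly divides X(r)
-- and j < L, then a·f(n) = 4^j·(odd² − 4^(L−j)·Δ) = 4^j·odd, a terminating node of
-- valuation 2j.  If 2^i divides X(r) = 2^i·w with i ≤ L, then
-- a·f(n) = 4^i·((w + aq)² − 4^(L−i)·Δ), and the cofactor changes parity between q = 0
-- and q = 1, so the node does not terminate.  Since X(2^i + r) = X(r) + a·2^i, exactly
-- one child of such a node is again divisible by 2^(i+1); so below level ℓ every level
-- consists of one node of each kind.
module Submission where

open import Defs
open import Data.Nat as ℕ using (ℕ; zero; suc; _∸_)
open import Data.Integer as ℤ using (ℤ; +_; _%ℕ_; _/ℕ_; _*_; _+_; _-_)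
open import Data.Integer.Divisibility using (_∣_)
open import Data.Integer.Divisibility.Signed as Signed
  using (divides; ∣ᵤ⇒∣; ∣⇒∣ᵤ) renaming (_∣_ to _∣ˢ_)
open import Data.Integer.Tactic.RingSolver using (solve; solve-∀)
open import Data.List using (_∷_; [])
open import Data.Product using (∃; ∃₂; _×_; _,_; proj₁; proj₂)
open import Data.Sum using (_⊎_; inj₁; inj₂; [_,_]′; swap)
open import Data.Empty using (⊥-elim)
open import Function using (_∘_)
open import Relation.Nullary using (¬_; yes; no)
open import Relation.Binary.PropositionalEquality
  using (_≡_; refl; sym; trans; cong; subst; subst₂; cong₂; module ≡-Reasoning)
import Data.Nat.Properties as ℕₚ
import Data.Nat.Divisibility as ℕ∣
import Data.Integer.Properties as ℤₚ
import Data.Integer.DivMod as ℤ÷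

open ≡-Reasoning

Odd : ℤ → Set
Odd z = ∃ λ k → z ≡ k * + 2 + + 1

even-or-odd : ∀ z → + 2 ∣ˢ z ⊎ Odd z
even-or-odd z with z %ℕ 2 | ℤ÷.a≡a%ℕn+[a/ℕn]*n z 2 | ℤ÷.n%ℕd<d z 2
... | 0           | z≡ | _ = inj₁ (divides (z /ℕ 2) (trans z≡ (ℤₚ.+-identityˡ _)))
... | 1           | z≡ | _ = inj₂ (z /ℕ 2 , trans z≡ (ℤₚ.+-comm (+ 1) ((z /ℕ 2) * + 2)))
... | suc (suc _) | _  | ℕ.s≤s (ℕ.s≤s ())

even⇒¬odd : ∀ {z} → + 2 ∣ˢ z → ¬ Odd z
even⇒¬odd (divides k z≡2k) (m , z≡2m+1) with ℕ∣.∣1⇒≡1 (∣⇒∣ᵤ (divides (k - m) 1≡[k-m]2))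
  where
  1≡[k-m]2 : + 1 ≡ (k - m) * + 2
  1≡[k-m]2 = begin
    + 1                      ≡⟨ solve (m ∷ []) ⟩
    m * + 2 + + 1 - m * + 2  ≡⟨ cong (_- m * + 2) (trans (sym z≡2m+1) z≡2k) ⟩
    k * + 2 - m * + 2        ≡⟨ solve (k ∷ m ∷ []) ⟩
    (k - m) * + 2            ∎
... | ()

odd*odd : ∀ {x y} → Odd x → Odd y → Odd (x * y)
odd*odd (k , refl) (m , refl) = k * m * + 2 + k + m , solve (k ∷ m ∷ [])

odd+even : ∀ {x y} → Odd x → + 2 ∣ˢ y → Odd (x + y)
odd+even (k , refl) (divides m refl) = k + m , solve (k ∷ m ∷ [])

odd+odd : ∀ {x y} → Odd x → Odd y → + 2 ∣ˢ x + y
odd+odd (k , refl) (m , refl) = divides (k + m + + 1) (solve (k ∷ m ∷ []))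

+odd-flips-parity : ∀ {y} → Odd y → ∀ x → (Odd x × + 2 ∣ˢ x + y) ⊎ (+ 2 ∣ˢ x × Odd (x + y))
+odd-flips-parity {y} y-odd x with even-or-odd x
... | inj₂ x-odd  = inj₁ (x-odd , odd+odd x-odd y-odd)
... | inj₁ x-even = inj₂ (x-even , subst Odd (ℤₚ.+-comm y x) (odd+even y-odd x-even))

pow2 : ℕ → ℤ
pow2 k = + (2 ℕ.^ k)

pow2-suc : ∀ k → pow2 (suc k) ≡ + 2 * pow2 k
pow2-suc k = ℤₚ.pos-* 2 (2 ℕ.^ k)

^-monoʳ-∣ : ∀ b {m n} → m ℕ.≤ n → b ℕ.^ m ℕ∣.∣ b ℕ.^ n
^-monoʳ-∣ b {m} m≤n with ℕₚ.m≤n⇒∃[o]m+o≡n m≤n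
... | o , refl = ℕ∣.divides (b ℕ.^ o) (trans (ℕₚ.^-distribˡ-+-* b m o) (ℕₚ.*-comm (b ℕ.^ m) (b ℕ.^ o)))

exactVal-∣⇒≤ : ∀ {x k m} → ExactVal x m → + (2 ℕ.^ k) ∣ x → k ℕ.≤ m
exactVal-∣⇒≤ {k = k} {m} (_ , 2^[1+m]∤x) 2^k∣x with k ℕₚ.≤? m
... | yes k≤m = k≤m
... | no  k≰m = ⊥-elim (2^[1+m]∤x (ℕ∣.∣-trans (^-monoʳ-∣ 2 (ℕₚ.≰⇒> k≰m)) 2^k∣x))

odd-cofactor⇒exactVal : ∀ {x w} m → Odd w → x ≡ w * pow2 m → ExactVal x m
odd-cofactor⇒exactVal {x} {w} m w-odd x≡ = ∣⇒∣ᵤ (divides w x≡) , λ d → even⇒¬odd (2∣w d) w-odd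
  where
  2∣w : + (2 ℕ.^ suc m) ∣ x → + 2 ∣ˢ w
  2∣w d with ∣ᵤ⇒∣ d
  ... | divides q x≡q2^[1+m] = divides q (ℤₚ.*-cancelʳ-≡ w (q * + 2) (pow2 m) {{ℕₚ.m^n≢0 2 m}} (begin
    w * pow2 m         ≡⟨ sym x≡ ⟩
    x                  ≡⟨ x≡q2^[1+m] ⟩
    q * pow2 (suc m)   ≡⟨ cong (q *_) (pow2-suc m) ⟩
    q * (+ 2 * pow2 m) ≡⟨ sym (ℤₚ.*-assoc q (+ 2) (pow2 m)) ⟩
    q * + 2 * pow2 m   ∎))

even-cofactor⇒pow2-suc-∣ : ∀ {x w} m → + 2 ∣ˢ w → x ≡ w * pow2 m → pow2 (suc m) ∣ˢ x
even-cofactor⇒pow2-suc-∣ {x} m (divides v refl) x≡ = divides v (begin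
  x                   ≡⟨ x≡ ⟩
  v * + 2 * pow2 m    ≡⟨ ℤₚ.*-assoc v (+ 2) (pow2 m) ⟩
  v * (+ 2 * pow2 m)  ≡⟨ cong (v *_) (sym (pow2-suc m)) ⟩
  v * pow2 (suc m)    ∎)

exactVal⇒odd-cofactor : ∀ {x m} → ExactVal x m → ∃ λ w → Odd w × x ≡ w * pow2 m
exactVal⇒odd-cofactor {x} {m} (2^m∣x , 2^[1+m]∤x) with ∣ᵤ⇒∣ {pow2 m} {x} 2^m∣x
... | divides w x≡ with even-or-odd w
...   | inj₂ w-odd  = w , w-odd , x≡
...   | inj₁ w-even = ⊥-elim (2^[1+m]∤x (∣⇒∣ᵤ (even-cofactor⇒pow2-suc-∣ m w-even x≡)))

pow2∣-cancel-odd : ∀ {a y} → Odd a → ∀ k → pow2 k ∣ˢ a * y → pow2 k ∣ˢ y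
pow2∣-cancel-odd {y = y} _ zero _ = divides y (sym (ℤₚ.*-identityʳ y))
pow2∣-cancel-odd {a} {y} a-odd (suc k) 2^[1+k]∣ay with even-or-odd y
... | inj₂ y-odd = ⊥-elim (even⇒¬odd (Signed.∣-trans 2∣2^[1+k] 2^[1+k]∣ay) (odd*odd a-odd y-odd))
  where
  2∣2^[1+k] : + 2 ∣ˢ pow2 (suc k)
  2∣2^[1+k] = divides (pow2 k) (trans (pow2-suc k) (ℤₚ.*-comm (+ 2) (pow2 k)))
... | inj₁ (divides v refl) =
  subst (_∣ˢ v * + 2) (sym 2^[1+k]≡) (Signed.*-monoˡ-∣ (+ 2) (pow2∣-cancel-odd a-odd k 2^k∣av))
  where
  2^[1+k]≡ : pow2 (suc k) ≡ pow2 k * + 2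
  2^[1+k]≡ = trans (pow2-suc k) (ℤₚ.*-comm (+ 2) (pow2 k))
  2^k∣av : pow2 k ∣ˢ a * v
  2^k∣av = Signed.*-cancelʳ-∣ (+ 2)
    (subst₂ _∣ˢ_ 2^[1+k]≡ (sym (ℤₚ.*-assoc a v (+ 2))) 2^[1+k]∣ay)

exactVal-cancel-odd : ∀ {a y k} → Odd a → ExactVal (a * y) k → ExactVal y k
exactVal-cancel-odd {a} {y} {k} a-odd (2^k∣ay , 2^[1+k]∤ay) =
  ∣⇒∣ᵤ (pow2∣-cancel-odd a-odd k (∣ᵤ⇒∣ 2^k∣ay)) ,
  λ 2^[1+k]∣y → 2^[1+k]∤ay (∣⇒∣ᵤ (Signed.∣n⇒∣m*n a (∣ᵤ⇒∣ {pow2 (suc k)} {y} 2^[1+k]∣y)))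

exactVal-jump⇒¬terminating : ∀ {h i s q₀ q₁ m} → ExactVal (h (elt i s q₀)) m →
                             + (2 ℕ.^ suc m) ∣ h (elt i s q₁) → ¬ Terminating h i s
exactVal-jump⇒¬terminating {h} {i} {s} {q₀} {q₁} {m} exact₀ 2^[1+m]∣h₁ (inj₁ (k , exact)) =
  proj₂ (exact q₁) (ℕ∣.∣-trans (^-monoʳ-∣ 2 (ℕ.s≤s k≤m)) 2^[1+m]∣h₁)
  where
  k≤m : k ℕ.≤ m
  k≤m = exactVal-∣⇒≤ {h (elt i s q₀)} {k} {m} exact₀ (proj₁ (exact q₀))
exactVal-jump⇒¬terminating {q₀ = q₀} {m = m} exact₀ _ (inj₂ vanishes) =
  proj₂ exact₀ (subst (+ (2 ℕ.^ suc m) ∣_) (sym (vanishes q₀)) (ℕ∣._∣0 _))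

4^≡2^*2^ : ∀ k → + (4 ℕ.^ k) ≡ pow2 k * pow2 k
4^≡2^*2^ k = trans (cong +_ 4^k≡2^k*2^k) (ℤₚ.pos-* (2 ℕ.^ k) (2 ℕ.^ k))
  where
  4^k≡2^k*2^k : 4 ℕ.^ k ≡ 2 ℕ.^ k ℕ.* 2 ℕ.^ k
  4^k≡2^k*2^k = trans (ℕₚ.^-*-assoc 2 2 k)
    (trans (cong (λ e → 2 ℕ.^ (k ℕ.+ e)) (ℕₚ.+-identityʳ k)) (ℕₚ.^-distribˡ-+-* 2 k k))

level-zero : ∀ {f r} → IsNode f 0 r → r ≡ 0
level-zero root = refl

children-of-unique-branch : ∀ {f i s} → (∀ {r} → IsNode f i r → ¬ Terminating f i r → r ≡ s) →
                            ∀ {r} → IsNode f (suc i) r → r ≡ s ⊎ r ≡ 2 ℕ.^ i ℕ.+ s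
children-of-unique-branch unique (child₀ node ¬term) = inj₁ (unique node ¬term)
children-of-unique-branch {i = i} unique (child₁ node ¬term) =
  inj₂ (cong (2 ℕ.^ i ℕ.+_) (unique node ¬term))

reduced-discriminant : ∀ a b₀ c Δ L →
  b₀ * + 2 * (b₀ * + 2) - + 4 * a * c ≡ + (4 ℕ.^ suc L) * Δ → b₀ * b₀ - a * c ≡ + (4 ℕ.^ L) * Δ
reduced-discriminant a b₀ c Δ L disc = ℤₚ.*-cancelˡ-≡ (+ 4) _ _ (begin
  + 4 * (b₀ * b₀ - a * c)              ≡⟨ solve (a ∷ b₀ ∷ c ∷ []) ⟩
  b₀ * + 2 * (b₀ * + 2) - + 4 * a * c  ≡⟨ disc ⟩
  + (4 ℕ.^ suc L) * Δ                  ≡⟨ cong (_* Δ) (ℤₚ.pos-* 4 (4 ℕ.^ L)) ⟩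
  + 4 * + (4 ℕ.^ L) * Δ                ≡⟨ ℤₚ.*-assoc (+ 4) (+ (4 ℕ.^ L)) Δ ⟩
  + 4 * (+ (4 ℕ.^ L) * Δ)              ∎)

module QuadraticTree (a b₀ c Δ : ℤ) (L : ℕ) (a-odd : Odd a)
                     (disc : b₀ * b₀ - a * c ≡ + (4 ℕ.^ L) * Δ) where

  f : ℕ → ℤ
  f = quad a (b₀ * + 2) c

  X : ℕ → ℤ
  X n = a * + n + b₀

  a*f≡X²-4^LΔ : ∀ n → a * f n ≡ X n * X n - + (4 ℕ.^ L) * Δ
  a*f≡X²-4^LΔ n = trans (completing-square a b₀ c (+ n)) (cong (λ y → X n * X n - y) disc)
    where
    completing-square : ∀ a b₀ c x →
      a * (a * x * x + b₀ * + 2 * x + c) ≡ (a * x + b₀) * (a * x + b₀) - (b₀ * b₀ - a * c)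
    completing-square = solve-∀

  a*f-factor : ∀ n k d u → k ℕ.+ d ≡ L → X n ≡ u * pow2 k →
               a * f n ≡ (u * u - + (4 ℕ.^ d) * Δ) * pow2 (2 ℕ.* k)
  a*f-factor n k d u k+d≡L X≡ = begin
    a * f n                                                ≡⟨ a*f≡X²-4^LΔ n ⟩
    X n * X n - + (4 ℕ.^ L) * Δ                            ≡⟨ cong₂ (λ x p → x * x - p * Δ) X≡ 4^L≡ ⟩
    u * pow2 k * (u * pow2 k) - pow2 k * pow2 k * + (4 ℕ.^ d) * Δ
                                                           ≡⟨ factor u (pow2 k) (+ (4 ℕ.^ d)) Δ ⟩
    (u * u - + (4 ℕ.^ d) * Δ) * (pow2 k * pow2 k)          ≡⟨ cong ((u * u - + (4 ℕ.^ d) * Δ) *_) 2^k*2^k≡2^[2k] ⟩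
    (u * u - + (4 ℕ.^ d) * Δ) * pow2 (2 ℕ.* k)             ∎
    where
    factor : ∀ u p q Δ → u * p * (u * p) - p * p * q * Δ ≡ (u * u - q * Δ) * (p * p)
    factor = solve-∀
    4^L≡ : + (4 ℕ.^ L) ≡ pow2 k * pow2 k * + (4 ℕ.^ d)
    4^L≡ = begin
      + (4 ℕ.^ L)                   ≡⟨ cong (λ e → + (4 ℕ.^ e)) (sym k+d≡L) ⟩
      + (4 ℕ.^ (k ℕ.+ d))           ≡⟨ cong +_ (ℕₚ.^-distribˡ-+-* 4 k d) ⟩
      + (4 ℕ.^ k ℕ.* 4 ℕ.^ d)       ≡⟨ ℤₚ.pos-* (4 ℕ.^ k) (4 ℕ.^ d) ⟩
      + (4 ℕ.^ k) * + (4 ℕ.^ d)     ≡⟨ cong (_* + (4 ℕ.^ d)) (4^≡2^*2^ k) ⟩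
      pow2 k * pow2 k * + (4 ℕ.^ d) ∎
    2^k*2^k≡2^[2k] : pow2 k * pow2 k ≡ pow2 (2 ℕ.* k)
    2^k*2^k≡2^[2k] = trans (sym (4^≡2^*2^ k)) (cong +_ (ℕₚ.^-*-assoc 2 2 k))

  X-elt : ∀ i r q → X (elt i r q) ≡ X r + a * + q * pow2 i
  X-elt i r q = begin
    a * + (2 ℕ.^ i ℕ.* q ℕ.+ r) + b₀      ≡⟨ cong (λ m → a * m + b₀) (ℤₚ.pos-+ (2 ℕ.^ i ℕ.* q) r) ⟩
    a * (+ (2 ℕ.^ i ℕ.* q) + + r) + b₀    ≡⟨ cong (λ m → a * (m + + r) + b₀) (ℤₚ.pos-* (2 ℕ.^ i) q) ⟩
    a * (pow2 i * + q + + r) + b₀         ≡⟨ shift a b₀ (pow2 i) (+ q) (+ r) ⟩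
    a * + r + b₀ + a * + q * pow2 i       ∎
    where
    shift : ∀ a b₀ p q r → a * (p * q + r) + b₀ ≡ a * r + b₀ + a * q * p
    shift = solve-∀

  X-shift : ∀ i r → X (2 ℕ.^ i ℕ.+ r) ≡ X r + a * pow2 i
  X-shift i r = trans (cong (λ m → a * m + b₀) (ℤₚ.pos-+ (2 ℕ.^ i) r)) (shift a b₀ (pow2 i) (+ r))
    where
    shift : ∀ a b₀ p r → a * (p + r) + b₀ ≡ a * r + b₀ + a * p
    shift = solve-∀

  X-shift-cofactor : ∀ i {s w} → X s ≡ w * pow2 i → X (2 ℕ.^ i ℕ.+ s) ≡ (a + w) * pow2 i
  X-shift-cofactor i {s} {w} X≡ = begin
    X (2 ℕ.^ i ℕ.+ s)       ≡⟨ X-shift i s ⟩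
    X s + a * pow2 i        ≡⟨ cong (_+ a * pow2 i) X≡ ⟩
    w * pow2 i + a * pow2 i ≡⟨ ℤₚ.+-comm (w * pow2 i) (a * pow2 i) ⟩
    a * pow2 i + w * pow2 i ≡⟨ sym (ℤₚ.*-distribʳ-+ (pow2 i) a w) ⟩
    (a + w) * pow2 i        ∎

  split-children : ∀ {i s} → pow2 i ∣ˢ X s →
                   (pow2 (suc i) ∣ˢ X s × ExactVal (X (2 ℕ.^ i ℕ.+ s)) i) ⊎
                   (pow2 (suc i) ∣ˢ X (2 ℕ.^ i ℕ.+ s) × ExactVal (X s) i)
  split-children {i} (divides w X≡) with even-or-odd w
  ... | inj₁ w-even = inj₁ (even-cofactor⇒pow2-suc-∣ i w-even X≡ ,
                            odd-cofactor⇒exactVal i (odd+even a-odd w-even) (X-shift-cofactor i X≡))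
  ... | inj₂ w-odd  = inj₂ (even-cofactor⇒pow2-suc-∣ i (odd+odd a-odd w-odd) (X-shift-cofactor i X≡) ,
                            odd-cofactor⇒exactVal i w-odd X≡)

  odd-cofactor⇒exactVal-f : ∀ n {E} m → Odd E → a * f n ≡ E * pow2 m → ExactVal (f n) m
  odd-cofactor⇒exactVal-f n m E-odd a*f≡ =
    exactVal-cancel-odd {a} {f n} {m} a-odd (odd-cofactor⇒exactVal m E-odd a*f≡)

  even-cofactor⇒pow2-suc-∣-f : ∀ n {E} m → + 2 ∣ˢ E → a * f n ≡ E * pow2 m →
                                + (2 ℕ.^ suc m) ∣ f n
  even-cofactor⇒pow2-suc-∣-f n m E-even a*f≡ =
    ∣⇒∣ᵤ (pow2∣-cancel-odd a-odd (suc m) (even-cofactor⇒pow2-suc-∣ m E-even a*f≡))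

  leaf-valuation : ∀ {j t} → j ℕ.< L → ExactVal (X t) j →
                   ∀ q → ExactVal (f (elt (suc j) t q)) (2 ℕ.* j)
  leaf-valuation {j} {t} j<L X-exact q
    with exactVal⇒odd-cofactor {X t} {j} X-exact | ℕₚ.m≤n⇒∃[o]m+o≡n j<L
  ... | w , w-odd , X≡ | d , 1+j+d≡L =
    odd-cofactor⇒exactVal-f (elt (suc j) t q) (2 ℕ.* j) E-odd
      (a*f-factor (elt (suc j) t q) j (suc d) u (trans (ℕₚ.+-suc j d) 1+j+d≡L) X[elt]≡)
    where
    u : ℤ
    u = w + a * + q * + 2
    4^[1+d] : ℤ
    4^[1+d] = + (4 ℕ.^ suc d)
    E-odd : Odd (u * u - 4^[1+d] * Δ)
    E-odd = odd+even (odd*odd u-odd u-odd)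
      (Signed.∣m⇒∣-m {+ 2} {4^[1+d] * Δ} (Signed.∣m⇒∣m*n Δ
        (∣ᵤ⇒∣ {+ 2} {4^[1+d]} (ℕ∣.∣m⇒∣m*n (4 ℕ.^ d) (ℕ∣.divides 2 refl)))))
      where
      u-odd : Odd u
      u-odd = odd+even w-odd (divides (a * + q) refl)
    X[elt]≡ : X (elt (suc j) t q) ≡ u * pow2 j
    X[elt]≡ = begin
      X (elt (suc j) t q)                    ≡⟨ X-elt (suc j) t q ⟩
      X t + a * + q * pow2 (suc j)           ≡⟨ cong₂ (λ x p → x + a * + q * p) {X t} X≡ (pow2-suc j) ⟩
      w * pow2 j + a * + q * (+ 2 * pow2 j)  ≡⟨ regroup w (a * + q) (pow2 j) ⟩
      u * pow2 j                             ∎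
      where
      regroup : ∀ w x p → w * p + x * (+ 2 * p) ≡ (w + x * + 2) * p
      regroup = solve-∀

  branch-cofactor : ∀ {i s} → i ℕ.≤ L → pow2 i ∣ˢ X s →
    ∃ λ (E : ℕ → ℤ) → (∀ q → a * f (elt i s q) ≡ E q * pow2 (2 ℕ.* i)) ×
                      ((Odd (E 0) × + 2 ∣ˢ E 1) ⊎ (+ 2 ∣ˢ E 0 × Odd (E 1)))
  branch-cofactor {i} {s} i≤L (divides w X≡) with ℕₚ.m≤n⇒∃[o]m+o≡n i≤L
  ... | d , i+d≡L =
    E , a*f≡ , subst (λ e → (Odd (E 0) × + 2 ∣ˢ e) ⊎ (+ 2 ∣ˢ E 0 × Odd e)) E₀+odd≡E₁
                     (+odd-flips-parity (odd*odd a-odd (odd+even a-odd (divides w refl))) (E 0))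
    where
    E : ℕ → ℤ
    E q = (w + a * + q) * (w + a * + q) - + (4 ℕ.^ d) * Δ
    a*f≡ : ∀ q → a * f (elt i s q) ≡ E q * pow2 (2 ℕ.* i)
    a*f≡ q = a*f-factor (elt i s q) i d (w + a * + q) i+d≡L (begin
      X (elt i s q)                  ≡⟨ X-elt i s q ⟩
      X s + a * + q * pow2 i         ≡⟨ cong (_+ a * + q * pow2 i) X≡ ⟩
      w * pow2 i + a * + q * pow2 i  ≡⟨ sym (ℤₚ.*-distribʳ-+ (pow2 i) w (a * + q)) ⟩
      (w + a * + q) * pow2 i         ∎)
    E₀+odd≡E₁ : E 0 + a * (a + w * + 2) ≡ E 1
    E₀+odd≡E₁ = step a w (+ (4 ℕ.^ d) * Δ)
      where
      step : ∀ a w F → (w + a * + 0) * (w + a * + 0) - F + a * (a + w * + 2) ≡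
                       (w + a * + 1) * (w + a * + 1) - F
      step = solve-∀

  branch-nonterminating : ∀ {i s} → i ℕ.≤ L → pow2 i ∣ˢ X s → ¬ Terminating f i s
  branch-nonterminating {i} {s} i≤L 2^i∣X with branch-cofactor i≤L 2^i∣X
  ... | E , a*f≡ , inj₁ (odd₀ , even₁) = exactVal-jump⇒¬terminating {f} {i} {s} {0} {1} {2 ℕ.* i}
    (odd-cofactor⇒exactVal-f (elt i s 0) (2 ℕ.* i) odd₀ (a*f≡ 0))
    (even-cofactor⇒pow2-suc-∣-f (elt i s 1) (2 ℕ.* i) even₁ (a*f≡ 1))
  ... | E , a*f≡ , inj₂ (even₀ , odd₁) = exactVal-jump⇒¬terminating {f} {i} {s} {1} {0} {2 ℕ.* i}
    (odd-cofactor⇒exactVal-f (elt i s 1) (2 ℕ.* i) odd₁ (a*f≡ 1))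
    (even-cofactor⇒pow2-suc-∣-f (elt i s 0) (2 ℕ.* i) even₀ (a*f≡ 0))

  branch-divisible : ∀ {i s} → i ℕ.≤ L → pow2 i ∣ˢ X s → ∀ q → + (2 ℕ.^ (2 ℕ.* i)) ∣ f (elt i s q)
  branch-divisible {i} i≤L 2^i∣X q with branch-cofactor i≤L 2^i∣X
  ... | E , a*f≡ , _ = ∣⇒∣ᵤ (pow2∣-cancel-odd a-odd (2 ℕ.* i) (divides (E q) (a*f≡ q)))

  -- Level j describes the nodes at level j + 1.
  record Level (j : ℕ) : Set where
    field
      branch leaf : ℕ
      branch-node : IsNode f (suc j) branch
      leaf-node   : IsNode f (suc j) leaf
      branch-X    : pow2 (suc j) ∣ˢ X branch
      leaf-X      : ExactVal (X leaf) j
      nodes       : ∀ r → IsNode f (suc j) r → r ≡ branch ⊎ r ≡ leaf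

  next-level : ∀ {i s} → i ℕ.≤ L → IsNode f i s → pow2 i ∣ˢ X s →
            (∀ {r} → IsNode f i r → ¬ Terminating f i r → r ≡ s) → Level i
  next-level {i} {s} i≤L node 2^i∣X unique = [ branch-stays , branch-moves ]′ (split-children {i} 2^i∣X)
    where
    ¬term : ¬ Terminating f i s
    ¬term = branch-nonterminating i≤L 2^i∣X
    branch-stays : pow2 (suc i) ∣ˢ X s × ExactVal (X (2 ℕ.^ i ℕ.+ s)) i → Level i
    branch-stays (2^[1+i]∣X , leaf-exact) = record
      { branch = s ; leaf = 2 ℕ.^ i ℕ.+ s
      ; branch-node = child₀ node ¬term ; leaf-node = child₁ node ¬term
      ; branch-X = 2^[1+i]∣X ; leaf-X = leaf-exact
      ; nodes = λ _ → children-of-unique-branch unique }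
    branch-moves : pow2 (suc i) ∣ˢ X (2 ℕ.^ i ℕ.+ s) × ExactVal (X s) i → Level i
    branch-moves (2^[1+i]∣X , leaf-exact) = record
      { branch = 2 ℕ.^ i ℕ.+ s ; leaf = s
      ; branch-node = child₁ node ¬term ; leaf-node = child₀ node ¬term
      ; branch-X = 2^[1+i]∣X ; leaf-X = leaf-exact
      ; nodes = λ _ → swap ∘ children-of-unique-branch unique }

  level : ∀ j → j ℕ.< L → Level j
  level zero _ =
    next-level ℕ.z≤n root (divides (X 0) (sym (ℤₚ.*-identityʳ (X 0)))) λ node _ → level-zero node
  level (suc j) 1+j<L = next-level j<L branch-node branch-X unique
    where
    j<L : j ℕ.< L
    j<L = ℕₚ.<⇒≤ 1+j<L
    open Level (level j j<L)
    unique : ∀ {r} → IsNode f (suc j) r → ¬ Terminating f (suc j) r → r ≡ branch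
    unique {r} node ¬term with nodes r node
    ... | inj₁ r≡branch = r≡branch
    ... | inj₂ refl     = ⊥-elim (¬term (inj₁ (2 ℕ.* j , leaf-valuation j<L leaf-X)))

lemma14 : (a b c Δ : ℤ) (ℓ : ℕ) →
    ¬ ((+ 2) ∣ a) → (+ 2) ∣ b →
    b ℤ.* b ℤ.- (+ 4) ℤ.* a ℤ.* c ≡ (+ (4 ℕ.^ ℓ)) ℤ.* Δ →
    (∀ k → (+ (4 ℕ.^ k)) ∣ (b ℤ.* b ℤ.- (+ 4) ℤ.* a ℤ.* c) → k ℕ.≤ ℓ) →
    2 ℕ.≤ ℓ →
    (Δ %ℕ 8 ≡ 2 ⊎ Δ %ℕ 8 ≡ 3 ⊎ Δ %ℕ 8 ≡ 5 ⊎ Δ %ℕ 8 ≡ 6 ⊎ Δ %ℕ 8 ≡ 7) →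
    (i : ℕ) → 0 ℕ.< i → i ℕ.< ℓ →
    ∃₂ λ r₁ r₂ →
      IsNode (quad a b c) i r₁ × Terminating (quad a b c) i r₁ ×
      IsNode (quad a b c) i r₂ × ¬ Terminating (quad a b c) i r₂ ×
      (∀ r → IsNode (quad a b c) i r → r ≡ r₁ ⊎ r ≡ r₂) ×
      (∀ q → ExactVal (quad a b c (elt i r₁ q)) (2 ℕ.* (i ∸ 1))) ×
      (∀ q → (+ (2 ℕ.^ (2 ℕ.* i))) ∣ quad a b c (elt i r₂ q))
lemma14 _ _ _ _ zero    _ _ _ _ _ _ _       _ ()
lemma14 _ _ _ _ (suc L) _ _ _ _ _ _ zero    () _
-- Δ mod 8, the maximality of ℓ and ℓ ≥ 2 only matter from level ℓ on.
lemma14 a b c Δ (suc L) 2∤a 2∣b disc _ _ _ (suc j) _ (ℕ.s≤s j<L) with ∣ᵤ⇒∣ {+ 2} {b} 2∣b | even-or-odd a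
... | _               | inj₁ 2∣a  = ⊥-elim (2∤a (∣⇒∣ᵤ 2∣a))
... | divides b₀ refl | inj₂ a-odd =
  leaf , branch , leaf-node , inj₁ (2 ℕ.* j , leaf-valuation j<L leaf-X) ,
  branch-node , branch-nonterminating j<L branch-X ,
  (λ r node → swap (nodes r node)) ,
  leaf-valuation j<L leaf-X , branch-divisible j<L branch-X
  where
  open QuadraticTree a b₀ c Δ L a-odd (reduced-discriminant a b₀ c Δ L disc)
  open Level (level j j<L)
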